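{- Let $n\ge 3$, $m\ge 4$ and $1\le r\le m$ be integers such that $m$ and $n+r$ are even (so $T(n,m,r)$ is bipartite). Then the flip graph of $T(n,m,r)$ has at least $2\lfloor n/2\rfloor-1$ components having at least two vertices.
   Context: Write $Z_k=\{0,1,\dots,k-1\}$. $T(n,m,r)$ is the graph with vertex set $\{v_{i,j}: i\in Z_n, j\in Z_m\}$ (second index modulo $m$) and edges $v_{i,j}v_{i,j+1}$, $v_{i,j}v_{i+1,j}$ ($0\le i\le n-2$), $v_{n-1,j}v_{0,j+r}$, embedded on the torus with faces $v_{i,j}v_{i,j+1}v_{i+1,j+1}v_{i+1,j}$ ($0\le i\le n-2$) and $v_{n-1,j}v_{n-1,j+1}v_{0,j+r+1}v_{0,j+r}$ ($j\in Z_m$). The flip graph has as vertices the perfect matchings (domino tilings), two adjacent iff their symmetric difference is the boundary of a face. -}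

module Defs where

open import Data.Nat using (ℕ; _+_; _≡ᵇ_; NonZero)
open import Data.Nat.DivMod using (_mod_)
open import Data.Fin using (Fin; toℕ)
open import Data.Bool using (if_then_else_)
open import Data.Product using (_×_; _,_; Σ; ∃)
open import Data.Sum using (_⊎_)
open import Relation.Binary.PropositionalEquality using (_≡_; _≢_)
open import Relation.Nullary using (¬_)
open import Relation.Binary.Construct.Closure.ReflexiveTransitive using (Star)

-- The graph T(n,m,r).  Vertex v_{i,j} is the pair (i , j) : Fin n × Fin m.
module Torus (n m r : ℕ) .{{_ : NonZero n}} .{{_ : NonZero m}} where

  Vertex : Set
  Vertex = Fin n × Fin m

  right : Vertex → Vertex
  right (i , j) = i , ((toℕ j + 1) mod m)

  down : Vertex → Vertex
  down (i , j) =
    ((toℕ i + 1) mod n) ,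
    (if (toℕ i + 1) ≡ᵇ n then (toℕ j + r) mod m else j)

  Adj : Vertex → Vertex → Set
  Adj u v = (v ≡ right u) ⊎ (u ≡ right v) ⊎ (v ≡ down u) ⊎ (u ≡ down v)

  -- A perfect matching, given by its mate function: every vertex v is
  -- covered by exactly one matching edge, namely {v , mate v}.
  record PerfectMatching : Set where
    field
      mate  : Vertex → Vertex
      invol : ∀ v → mate (mate v) ≡ v
      adj   : ∀ v → Adj v (mate v)
  open PerfectMatching public

  -- Faces are indexed by their corner v_{i,j}; the face with corner a has
  -- boundary cycle a , right a , down (right a) , down a.
  Face : Set
  Face = Vertex

  FaceEdge : Face → Vertex → Vertex → Set
  FaceEdge a u v =
    let b = right a ; c = down (right a) ; d = down a in
      (u ≡ a × v ≡ b) ⊎ (u ≡ b × v ≡ a)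
    ⊎ (u ≡ b × v ≡ c) ⊎ (u ≡ c × v ≡ b)
    ⊎ (u ≡ c × v ≡ d) ⊎ (u ≡ d × v ≡ c)
    ⊎ (u ≡ d × v ≡ a) ⊎ (u ≡ a × v ≡ d)

  InSymDiff : PerfectMatching → PerfectMatching → Vertex → Vertex → Set
  InSymDiff M N u v = (mate M u ≡ v × mate N u ≢ v) ⊎ (mate N u ≡ v × mate M u ≢ v)

  Flip : PerfectMatching → PerfectMatching → Set
  Flip M N = Σ Face λ f → ∀ u v →
    (InSymDiff M N u v → FaceEdge f u v) × (FaceEdge f u v → InSymDiff M N u v)

  Connected : PerfectMatching → PerfectMatching → Set
  Connected = Star Flip

  SameMatching : PerfectMatching → PerfectMatching → Set
  SameMatching M N = ∀ v → mate M v ≡ mate N v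

  NontrivialComponent : PerfectMatching → Set
  NontrivialComponent M = ∃ λ N → Connected M N × ¬ SameMatching M N

-- Colour v(i,j) by the parity of i + j and let the flux of a perfect matching be the sum,
-- over the vertices v matched to their right neighbour, of +1 or -1 according to the colour
-- of v.  A flip at a face removes or creates exactly its two horizontal edges, whose left
-- endpoints are vertically adjacent and hence of opposite colour (this is where m and n + r
-- even are used), so the flux is constant on each component of the flip graph.
-- For t = 0, ..., n - 2 let M_t match every vertex horizontally, rightwards from colour 0 in
-- row 0, from colour 1 in row 1, and in row k + 2 from colour 0 iff k < t.  The flux of M_t
-- is (m/2)(2t - n + 2), so these n - 1 ≥ 2⌊n/2⌋ - 1 matchings lie in distinct components,
-- and each is nontrivial because the face at v(0,0) has both its horizontal edges in M_t.

module Submission where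

open import Defs

open import Algebra.Bundles using (CommutativeMonoid)
open import Data.Bool using (true; false; if_then_else_; T)
open import Data.Empty using (⊥-elim)
open import Data.Fin as Fin using (Fin; toℕ)
import Data.Fin.Properties as FinP
open import Data.Integer as ℤ using (ℤ; +_)
import Data.Integer.Properties as ℤP
open import Data.Integer.Tactic.RingSolver using (solve-∀)
open import Data.Nat as ℕ using (ℕ; zero; suc; NonZero; _%_; _/_; _∸_; _≤_; _<_; _+_; _*_)
open import Data.Nat.DivMod
open import Data.Nat.Divisibility using (_∣_; divides; ∣⇒≤)
import Data.Nat.Properties as ℕP
open import Data.Parity as ℙ using (Parity; 0ℙ; 1ℙ; _⁻¹)
import Data.Parity.Properties as ℙP
open import Data.Product using (Σ; _×_; _,_; proj₁; proj₂)
open import Data.Product.Properties using (≡-dec)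
open import Data.Sum using (_⊎_; inj₁; inj₂; [_,_]′)
open import Data.Unit using (tt)
open import Data.Vec.Functional using (removeAt)
open import Function using (_∘_)
open import Relation.Binary.Construct.Closure.ReflexiveTransitive using (ε; _◅_)
open import Relation.Binary.Definitions using (DecidableEquality)
open import Relation.Binary.PropositionalEquality using (_≡_; _≢_; refl; sym; trans; cong; cong₂; subst; module ≡-Reasoning)
open import Relation.Nullary using (¬_; does; yes; no)
open import Relation.Nullary.Decidable using (dec-true; dec-false)

open import Algebra.Properties.AbelianGroup ℤP.+-0-abelianGroup using (∙-cancelʳ)

[m%d+n]%d≡[m+n]%d : ∀ m n d .{{_ : NonZero d}} → (m % d ℕ.+ n) % d ≡ (m ℕ.+ n) % d
[m%d+n]%d≡[m+n]%d m n d = begin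
  (m % d ℕ.+ n) % d          ≡⟨ %-distribˡ-+ (m % d) n d ⟩
  (m % d % d ℕ.+ n % d) % d  ≡⟨ cong (λ x → (x ℕ.+ n % d) % d) (m%n%n≡m%n m d) ⟩
  (m % d ℕ.+ n % d) % d      ≡⟨ %-distribˡ-+ m n d ⟨
  (m ℕ.+ n) % d              ∎
  where open ≡-Reasoning

parity-even : ∀ {d} → 2 ∣ d → ℕ.parity d ≡ 0ℙ
parity-even (divides c refl) = trans (ℙP.*-homo-* c 2) (ℙP.*-zeroʳ (ℕ.parity c))

parity-% : ∀ x d .{{_ : NonZero d}} → 2 ∣ d → ℕ.parity (x % d) ≡ ℕ.parity x
parity-% x d 2∣d = sym (begin
  ℕ.parity x                                           ≡⟨ cong ℕ.parity (m≡m%n+[m/n]*n x d) ⟩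
  ℕ.parity (x % d ℕ.+ x / d ℕ.* d)                     ≡⟨ ℙP.+-homo-+ (x % d) _ ⟩
  ℕ.parity (x % d) ℙ.+ ℕ.parity (x / d ℕ.* d)          ≡⟨ cong (ℕ.parity (x % d) ℙ.+_) (ℙP.*-homo-* (x / d) d) ⟩
  ℕ.parity (x % d) ℙ.+ (ℕ.parity (x / d) ℙ.* ℕ.parity d) ≡⟨ cong (λ p → ℕ.parity (x % d) ℙ.+ (ℕ.parity (x / d) ℙ.* p)) (parity-even 2∣d) ⟩
  ℕ.parity (x % d) ℙ.+ (ℕ.parity (x / d) ℙ.* 0ℙ)        ≡⟨ cong (ℕ.parity (x % d) ℙ.+_) (ℙP.*-zeroʳ _) ⟩
  ℕ.parity (x % d) ℙ.+ 0ℙ                              ≡⟨ ℙP.+-identityʳ _ ⟩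
  ℕ.parity (x % d)                                     ∎)
  where open ≡-Reasoning

parity-suc : ∀ k → ℕ.parity (suc k) ≡ ℕ.parity k ⁻¹
parity-suc k = sym (ℙP.⁻¹-selfInverse (ℙP.suc-homo-⁻¹ k))

parity-sum-even : ∀ a b → 2 ∣ a ℕ.+ b → ℕ.parity a ≡ ℕ.parity b
parity-sum-even a b 2∣a+b = ℙP.+-cancelʳ-≡ (ℕ.parity b) _ _ (begin
  ℕ.parity a ℙ.+ ℕ.parity b  ≡⟨ ℙP.+-homo-+ a b ⟨
  ℕ.parity (a ℕ.+ b)         ≡⟨ parity-even 2∣a+b ⟩
  0ℙ                         ≡⟨ ℙP.p+p≡0ℙ (ℕ.parity b) ⟨
  ℕ.parity b ℙ.+ ℕ.parity b  ∎)
  where open ≡-Reasoning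

⁻¹-+ : ∀ p q → p ⁻¹ ℙ.+ q ≡ (p ℙ.+ q) ⁻¹
⁻¹-+ 0ℙ q = refl
⁻¹-+ 1ℙ q = sym (ℙP.⁻¹-involutive q)

+-⁻¹ : ∀ p q → p ℙ.+ q ⁻¹ ≡ (p ℙ.+ q) ⁻¹
+-⁻¹ p q = begin
  p ℙ.+ q ⁻¹    ≡⟨ ℙP.+-comm p (q ⁻¹) ⟩
  q ⁻¹ ℙ.+ p    ≡⟨ ⁻¹-+ q p ⟩
  (q ℙ.+ p) ⁻¹  ≡⟨ cong _⁻¹ (ℙP.+-comm q p) ⟩
  (p ℙ.+ q) ⁻¹  ∎
  where open ≡-Reasoning

module _ {d : ℕ} .{{_ : NonZero d}} where

  -- Definitionally, right (i , j) ≡ (i , rotate 1 j) and the row of down (i , j) is rotate 1 i.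
  rotate : ℕ → Fin d → Fin d
  rotate k j = (toℕ j ℕ.+ k) mod d

  toℕ-rotate : ∀ k j → toℕ (rotate k j) ≡ (toℕ j ℕ.+ k) % d
  toℕ-rotate k j = FinP.toℕ-fromℕ< _

  rotate-rotate : ∀ k l j → rotate l (rotate k j) ≡ rotate (k ℕ.+ l) j
  rotate-rotate k l j = FinP.toℕ-injective (begin
    toℕ (rotate l (rotate k j))     ≡⟨ toℕ-rotate l (rotate k j) ⟩
    (toℕ (rotate k j) ℕ.+ l) % d    ≡⟨ cong (λ x → (x ℕ.+ l) % d) (toℕ-rotate k j) ⟩
    ((toℕ j ℕ.+ k) % d ℕ.+ l) % d   ≡⟨ [m%d+n]%d≡[m+n]%d (toℕ j ℕ.+ k) l d ⟩
    (toℕ j ℕ.+ k ℕ.+ l) % d         ≡⟨ cong (_% d) (ℕP.+-assoc (toℕ j) k l) ⟩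
    (toℕ j ℕ.+ (k ℕ.+ l)) % d       ≡⟨ toℕ-rotate (k ℕ.+ l) j ⟨
    toℕ (rotate (k ℕ.+ l) j)        ∎)
    where open ≡-Reasoning

  rotate-comm : ∀ k l j → rotate l (rotate k j) ≡ rotate k (rotate l j)
  rotate-comm k l j = begin
    rotate l (rotate k j)  ≡⟨ rotate-rotate k l j ⟩
    rotate (k ℕ.+ l) j     ≡⟨ cong (λ s → rotate s j) (ℕP.+-comm k l) ⟩
    rotate (l ℕ.+ k) j     ≡⟨ rotate-rotate l k j ⟨
    rotate k (rotate l j)  ∎
    where open ≡-Reasoning

  rotate-by-modulus : ∀ j → rotate d j ≡ j
  rotate-by-modulus j = FinP.toℕ-injective (begin
    toℕ (rotate d j)    ≡⟨ toℕ-rotate d j ⟩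
    (toℕ j ℕ.+ d) % d   ≡⟨ [m+n]%n≡m%n (toℕ j) d ⟩
    toℕ j % d           ≡⟨ m<n⇒m%n≡m (FinP.toℕ<n j) ⟩
    toℕ j               ∎)
    where open ≡-Reasoning

  -- A fixed point of rotation by k forces d ∣ k.
  rotate-≢ : ∀ {k} (j : Fin d) → 0 < k → k < d → rotate k j ≢ j
  rotate-≢ {k} j 0<k k<d fixed = ℕP.<⇒≱ k<d (∣⇒≤ {{ℕ.>-nonZero 0<k}} d∣k)
    where
    y = toℕ j
    d∣k : d ∣ k
    d∣k = divides ((y ℕ.+ k) / d) (ℕP.+-cancelˡ-≡ y k _ (begin
      y ℕ.+ k                                  ≡⟨ m≡m%n+[m/n]*n (y ℕ.+ k) d ⟩
      (y ℕ.+ k) % d ℕ.+ (y ℕ.+ k) / d ℕ.* d    ≡⟨ cong (ℕ._+ (y ℕ.+ k) / d ℕ.* d) (trans (sym (toℕ-rotate k j)) (cong toℕ fixed)) ⟩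
      y ℕ.+ (y ℕ.+ k) / d ℕ.* d                ∎))
      where open ≡-Reasoning

  toℕ-rotate-last : ∀ (i : Fin d) → toℕ i ℕ.+ 1 ≡ d → toℕ (rotate 1 i) ≡ 0
  toℕ-rotate-last i i+1≡d = trans (toℕ-rotate 1 i) (trans (cong (_% d) i+1≡d) (n%n≡0 d))

  toℕ-rotate-inner : ∀ (i : Fin d) → toℕ i ℕ.+ 1 ≢ d → toℕ (rotate 1 i) ≡ suc (toℕ i)
  toℕ-rotate-inner i i+1≢d = begin
    toℕ (rotate 1 i)       ≡⟨ toℕ-rotate 1 i ⟩
    (toℕ i ℕ.+ 1) % d      ≡⟨ m<n⇒m%n≡m (ℕP.≤∧≢⇒< i+1≤d i+1≢d) ⟩
    toℕ i ℕ.+ 1            ≡⟨ ℕP.+-comm (toℕ i) 1 ⟩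
    suc (toℕ i)            ∎
    where
    open ≡-Reasoning
    i+1≤d : toℕ i ℕ.+ 1 ≤ d
    i+1≤d = subst (_≤ d) (ℕP.+-comm 1 (toℕ i)) (FinP.toℕ<n i)

  parity-rotate : 2 ∣ d → ∀ k j → ℕ.parity (toℕ (rotate k j)) ≡ ℕ.parity (toℕ j) ℙ.+ ℕ.parity k
  parity-rotate 2∣d k j = begin
    ℕ.parity (toℕ (rotate k j))        ≡⟨ cong ℕ.parity (toℕ-rotate k j) ⟩
    ℕ.parity ((toℕ j ℕ.+ k) % d)       ≡⟨ parity-% (toℕ j ℕ.+ k) d 2∣d ⟩
    ℕ.parity (toℕ j ℕ.+ k)             ≡⟨ ℙP.+-homo-+ (toℕ j) k ⟩
    ℕ.parity (toℕ j) ℙ.+ ℕ.parity k    ∎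
    where open ≡-Reasoning

module SumUpdate {c ℓ} (M : CommutativeMonoid c ℓ) where
  open CommutativeMonoid M
  open import Algebra.Properties.CommutativeMonoid.Sum M using (sum; sum-remove; sum-cong-≋)
  open import Algebra.Properties.CommutativeSemigroup commutativeSemigroup using (xy∙z≈xz∙y)
  open import Relation.Binary.Reasoning.Setoid setoid

  sum-update : ∀ {n} (f g : Fin n → Carrier) (i : Fin n) {x y : Carrier} →
               (∀ j → j ≢ i → f j ≈ g j) → f i ∙ x ≈ g i ∙ y → sum f ∙ x ≈ sum g ∙ y
  sum-update {suc _} f g i {x} {y} agree fi∙x≈gi∙y = begin
    sum f ∙ x                                 ≈⟨ ∙-congʳ (sum-remove {i = i} f) ⟩
    (f i ∙ sum (removeAt f i)) ∙ x            ≈⟨ xy∙z≈xz∙y _ _ _ ⟩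
    (f i ∙ x) ∙ sum (removeAt f i)            ≈⟨ ∙-cong fi∙x≈gi∙y (sum-cong-≋ λ j → agree _ (FinP.punchInᵢ≢i i j)) ⟩
    (g i ∙ y) ∙ sum (removeAt g i)            ≈⟨ xy∙z≈xz∙y _ _ _ ⟩
    (g i ∙ sum (removeAt g i)) ∙ y            ≈⟨ ∙-congʳ (sum-remove {i = i} g) ⟨
    sum g ∙ y                                 ∎

  sum₂ : ∀ {n m} → (Fin n × Fin m → Carrier) → Carrier
  sum₂ f = sum λ i → sum λ j → f (i , j)

  sum₂-update : ∀ {n m} (f g : Fin n × Fin m → Carrier) (a : Fin n × Fin m) {x y : Carrier} →
                (∀ v → v ≢ a → f v ≈ g v) → f a ∙ x ≈ g a ∙ y → sum₂ f ∙ x ≈ sum₂ g ∙ y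
  sum₂-update f g (i , j) agree fa∙x≈ga∙y =
    sum-update _ _ i
      (λ i′ i′≢i → sum-cong-≋ λ j′ → agree (i′ , j′) (i′≢i ∘ cong proj₁))
      (sum-update _ _ j (λ j′ j′≢j → agree (i , j′) (j′≢j ∘ cong proj₂)) fa∙x≈ga∙y)

_≟²_ : ∀ {n m} → DecidableEquality (Fin n × Fin m)
_≟²_ = ≡-dec FinP._≟_ FinP._≟_

open import Algebra.Properties.Semiring.Sum ℤP.+-*-semiring using (sum; sum-cong-≗; *-distribˡ-sum)
open SumUpdate ℤP.+-0-commutativeMonoid using (sum₂; sum₂-update)

sum₂-update₂ : ∀ {n m} (f g : Fin n × Fin m → ℤ) {a b} → a ≢ b →
               (∀ v → v ≢ a → v ≢ b → f v ≡ g v) → f a ℤ.+ f b ≡ g a ℤ.+ g b → sum₂ f ≡ sum₂ g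
sum₂-update₂ f g {a} {b} a≢b agree fa+fb≡ga+gb = ∙-cancelʳ (g a) _ _ (begin
  sum₂ f ℤ.+ g a  ≡⟨ sum₂-update f h a (λ v v≢a → sym (h-off v≢a)) (trans (ℤP.+-comm (f a) (g a)) (cong (ℤ._+ f a) (sym h-at-a))) ⟩
  sum₂ h ℤ.+ f a  ≡⟨ sum₂-update h g b h≡g-off-b hb+fa≡gb+ga ⟩
  sum₂ g ℤ.+ g a  ∎)
  where
  open ≡-Reasoning
  h : Fin _ × Fin _ → ℤ
  h v = if does (v ≟² a) then g a else f v
  h-at-a : h a ≡ g a
  h-at-a = cong (if_then g a else f a) (dec-true (a ≟² a) refl)
  h-off : ∀ {v} → v ≢ a → h v ≡ f v
  h-off {v} v≢a = cong (if_then g a else f v) (dec-false (v ≟² a) v≢a)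
  hb+fa≡gb+ga : h b ℤ.+ f a ≡ g b ℤ.+ g a
  hb+fa≡gb+ga = begin
    h b ℤ.+ f a  ≡⟨ cong (ℤ._+ f a) (h-off (a≢b ∘ sym)) ⟩
    f b ℤ.+ f a  ≡⟨ ℤP.+-comm (f b) (f a) ⟩
    f a ℤ.+ f b  ≡⟨ fa+fb≡ga+gb ⟩
    g a ℤ.+ g b  ≡⟨ ℤP.+-comm (g a) (g b) ⟩
    g b ℤ.+ g a  ∎
  h≡g-off-b : ∀ v → v ≢ b → h v ≡ g v
  h≡g-off-b v v≢b with v ≟² a
  ... | yes refl = refl
  ... | no v≢a = agree v v≢a v≢b

sign : Parity → ℤ
sign 0ℙ = + 1
sign 1ℙ = ℤ.-1ℤ

keepIf0ℙ : Parity → ℤ → ℤ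
keepIf0ℙ 0ℙ z = z
keepIf0ℙ 1ℙ _ = + 0

keepIf0ℙ-sign : ∀ p → keepIf0ℙ (p ℙ.+ 0ℙ) (sign 0ℙ) ℤ.+ keepIf0ℙ (p ℙ.+ 1ℙ) (sign 1ℙ) ≡ sign p
keepIf0ℙ-sign 0ℙ = refl
keepIf0ℙ-sign 1ℙ = refl

sign+sign⁻¹≡0 : ∀ p → sign p ℤ.+ sign (p ⁻¹) ≡ + 0
sign+sign⁻¹≡0 0ℙ = refl
sign+sign⁻¹≡0 1ℙ = refl

∑-alternating : ∀ {k} q → k ≡ q ℕ.* 2 → ∀ (G : Parity → ℤ) c →
                sum (λ (j : Fin k) → G (c ℙ.+ ℕ.parity (toℕ j))) ≡ + q ℤ.* (G 0ℙ ℤ.+ G 1ℙ)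
∑-alternating zero    refl G c = refl
∑-alternating (suc q) refl G c = begin
  G (c ℙ.+ 0ℙ) ℤ.+ (G (c ℙ.+ 1ℙ) ℤ.+ rest)  ≡⟨ ℤP.+-assoc (G (c ℙ.+ 0ℙ)) _ _ ⟨
  G (c ℙ.+ 0ℙ) ℤ.+ G (c ℙ.+ 1ℙ) ℤ.+ rest    ≡⟨ cong₂ ℤ._+_ (consecutive c) (∑-alternating q refl G c) ⟩
  S ℤ.+ + q ℤ.* S                           ≡⟨ ℤP.suc-* (+ q) S ⟨
  + suc q ℤ.* S                             ∎
  where
  open ≡-Reasoning
  S = G 0ℙ ℤ.+ G 1ℙ
  rest = sum λ (j : Fin (q ℕ.* 2)) → G (c ℙ.+ ℕ.parity (toℕ j))
  consecutive : ∀ c → G (c ℙ.+ 0ℙ) ℤ.+ G (c ℙ.+ 1ℙ) ≡ S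
  consecutive 0ℙ = refl
  consecutive 1ℙ = ℤP.+-comm (G 1ℙ) (G 0ℙ)

threshold : ℕ → ℕ → Parity
threshold t k = if k ℕ.<ᵇ t then 0ℙ else 1ℙ

∑-sign-threshold : ∀ L t → t ≤ L →
                   sum (λ (k : Fin L) → sign (threshold t (toℕ k))) ℤ.+ + L ≡ + (2 ℕ.* t)
∑-sign-threshold zero    zero    _         = refl
∑-sign-threshold (suc L) zero    _         = trans (shift (sum λ (k : Fin L) → sign (threshold 0 (toℕ k))) (+ L)) (∑-sign-threshold L zero ℕ.z≤n)
  where
  shift : ∀ x y → (ℤ.-1ℤ ℤ.+ x) ℤ.+ (+ 1 ℤ.+ y) ≡ x ℤ.+ y
  shift = solve-∀
∑-sign-threshold (suc L) (suc t) (ℕ.s≤s t≤L) = begin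
  (+ 1 ℤ.+ S) ℤ.+ + suc L   ≡⟨ shift S (+ L) ⟩
  (S ℤ.+ + L) ℤ.+ + 2       ≡⟨ cong (ℤ._+ + 2) (∑-sign-threshold L t t≤L) ⟩
  + (2 ℕ.* t) ℤ.+ + 2       ≡⟨ cong +_ (trans (ℕP.+-comm (2 ℕ.* t) 2) (sym (ℕP.*-suc 2 t))) ⟩
  + (2 ℕ.* suc t)           ∎
  where
  open ≡-Reasoning
  S = sum λ (k : Fin L) → sign (threshold t (toℕ k))
  shift : ∀ x y → (+ 1 ℤ.+ x) ℤ.+ (+ 1 ℤ.+ y) ≡ (x ℤ.+ y) ℤ.+ + 2
  shift = solve-∀

rowPhase : ℕ → ℕ → Parity
rowPhase t 0             = 0ℙ
rowPhase t 1             = 1ℙ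
rowPhase t (suc (suc k)) = threshold t k

∑-sign-rowPhase : ∀ L t → t ≤ L →
                  sum (λ (i : Fin (2 ℕ.+ L)) → sign (rowPhase t (toℕ i))) ℤ.+ + L ≡ + (2 ℕ.* t)
∑-sign-rowPhase L t t≤L = trans (cancel-±1 (sum λ (k : Fin L) → sign (threshold t (toℕ k))) (+ L)) (∑-sign-threshold L t t≤L)
  where
  cancel-±1 : ∀ x y → (+ 1 ℤ.+ (ℤ.-1ℤ ℤ.+ x)) ℤ.+ y ≡ x ℤ.+ y
  cancel-±1 = solve-∀

∑-sign-rowPhase-injective : ∀ {L s t} → s ≤ L → t ≤ L →
                            sum (λ (i : Fin (2 ℕ.+ L)) → sign (rowPhase s (toℕ i))) ≡
                            sum (λ (i : Fin (2 ℕ.+ L)) → sign (rowPhase t (toℕ i))) → s ≡ t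
∑-sign-rowPhase-injective {L} {s} {t} s≤L t≤L Σs≡Σt = ℕP.*-cancelˡ-≡ s t 2 (ℤP.+-injective (begin
  + (2 ℕ.* s)                                                 ≡⟨ ∑-sign-rowPhase L s s≤L ⟨
  sum (λ (i : Fin (2 ℕ.+ L)) → sign (rowPhase s (toℕ i))) ℤ.+ + L  ≡⟨ cong (ℤ._+ + L) Σs≡Σt ⟩
  sum (λ (i : Fin (2 ℕ.+ L)) → sign (rowPhase t (toℕ i))) ℤ.+ + L  ≡⟨ ∑-sign-rowPhase L t t≤L ⟩
  + (2 ℕ.* t)                                                 ∎))
  where open ≡-Reasoning

module _ {a} {A : Set a} (_≟_ : DecidableEquality A) where

  transpose : A → A → A → A
  transpose x y v with v ≟ x | v ≟ y
  ... | yes _ | _     = y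
  ... | no _  | yes _ = x
  ... | no _  | no _  = v

  transpose-fixes : ∀ {x y v} → v ≢ x → v ≢ y → transpose x y v ≡ v
  transpose-fixes {x} {y} {v} v≢x v≢y with v ≟ x | v ≟ y
  ... | yes v≡x | _       = ⊥-elim (v≢x v≡x)
  ... | no _    | yes v≡y = ⊥-elim (v≢y v≡y)
  ... | no _    | no _    = refl

  transpose-left : ∀ x y → transpose x y x ≡ y
  transpose-left x y with x ≟ x
  ... | yes _   = refl
  ... | no x≢x  = ⊥-elim (x≢x refl)

  transpose-right : ∀ x y → transpose x y y ≡ x
  transpose-right x y with y ≟ x | y ≟ y
  ... | yes y≡x | _       = y≡x
  ... | no _    | yes _   = refl
  ... | no _    | no y≢y  = ⊥-elim (y≢y refl)

  transpose-involutive : ∀ x y v → transpose x y (transpose x y v) ≡ v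
  transpose-involutive x y v with v ≟ x | v ≟ y
  ... | yes refl | _        = transpose-right x y
  ... | no _     | yes refl = transpose-left x y
  ... | no v≢x   | no v≢y   = transpose-fixes v≢x v≢y

module TorusProperties (n m r : ℕ) .{{_ : NonZero n}} .{{_ : NonZero m}} where

  open Torus n m r

  left : Vertex → Vertex
  left (i , j) = i , rotate (m ∸ 1) j

  left-right : ∀ v → left (right v) ≡ v
  left-right (i , j) = cong (i ,_) (begin
    rotate (m ∸ 1) (rotate 1 j)  ≡⟨ rotate-rotate 1 (m ∸ 1) j ⟩
    rotate (1 ℕ.+ (m ∸ 1)) j     ≡⟨ cong (λ k → rotate k j) (ℕP.m+[n∸m]≡n (ℕ.>-nonZero⁻¹ m)) ⟩
    rotate m j                   ≡⟨ rotate-by-modulus j ⟩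
    j                            ∎)
    where open ≡-Reasoning

  right-left : ∀ v → right (left v) ≡ v
  right-left (i , j) = cong (i ,_) (begin
    rotate 1 (rotate (m ∸ 1) j)  ≡⟨ rotate-rotate (m ∸ 1) 1 j ⟩
    rotate (m ∸ 1 ℕ.+ 1) j       ≡⟨ cong (λ k → rotate k j) (ℕP.m∸n+n≡m (ℕ.>-nonZero⁻¹ m)) ⟩
    rotate m j                   ≡⟨ rotate-by-modulus j ⟩
    j                            ∎)
    where open ≡-Reasoning

  right-down : ∀ v → right (down v) ≡ down (right v)
  right-down (i , j) = cong (rotate 1 i ,_) (column ((toℕ i ℕ.+ 1) ℕ.≡ᵇ n))
    where
    column : ∀ b → rotate 1 (if b then rotate r j else j) ≡ (if b then rotate r (rotate 1 j) else rotate 1 j)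
    column true  = rotate-comm r 1 j
    column false = refl

  row-right : ∀ v → proj₁ (right v) ≡ proj₁ v
  row-right (i , j) = refl

  row-down≢ : 2 ≤ n → ∀ v → proj₁ (down v) ≢ proj₁ v
  row-down≢ 2≤n (i , j) = rotate-≢ i (ℕ.s≤s ℕ.z≤n) 2≤n

  right≢ : 2 ≤ m → ∀ v → right v ≢ v
  right≢ 2≤m (i , j) = rotate-≢ j (ℕ.s≤s ℕ.z≤n) 2≤m ∘ cong proj₂

  right-right≢ : 3 ≤ m → ∀ v → right (right v) ≢ v
  right-right≢ 3≤m (i , j) eq = rotate-≢ j (ℕ.s≤s ℕ.z≤n) 3≤m (trans (sym (rotate-rotate 1 1 j)) (cong proj₂ eq))

  colour : Vertex → Parity
  colour (i , j) = ℕ.parity (toℕ i) ℙ.+ ℕ.parity (toℕ j)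

  colour-right : 2 ∣ m → ∀ v → colour (right v) ≡ colour v ⁻¹
  colour-right 2∣m (i , j) = begin
    ℕ.parity (toℕ i) ℙ.+ ℕ.parity (toℕ (rotate 1 j))     ≡⟨ cong (ℕ.parity (toℕ i) ℙ.+_) (parity-rotate 2∣m 1 j) ⟩
    ℕ.parity (toℕ i) ℙ.+ (ℕ.parity (toℕ j) ℙ.+ 1ℙ)      ≡⟨ cong (ℕ.parity (toℕ i) ℙ.+_) (ℙP.+-comm (ℕ.parity (toℕ j)) 1ℙ) ⟩
    ℕ.parity (toℕ i) ℙ.+ ℕ.parity (toℕ j) ⁻¹            ≡⟨ +-⁻¹ (ℕ.parity (toℕ i)) _ ⟩
    (ℕ.parity (toℕ i) ℙ.+ ℕ.parity (toℕ j)) ⁻¹          ∎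
    where open ≡-Reasoning

  colour-down : 2 ∣ m → 2 ∣ n ℕ.+ r → ∀ v → colour (down v) ≡ colour v ⁻¹
  colour-down 2∣m 2∣n+r (i , j) with (toℕ i ℕ.+ 1) ℕ.≡ᵇ n in isLast
  ... | false = begin
    ℕ.parity (toℕ (rotate 1 i)) ℙ.+ pj  ≡⟨ cong (λ k → ℕ.parity k ℙ.+ pj) (toℕ-rotate-inner i i+1≢n) ⟩
    ℕ.parity (suc (toℕ i)) ℙ.+ pj       ≡⟨ cong (ℙ._+ pj) (parity-suc (toℕ i)) ⟩
    pi ⁻¹ ℙ.+ pj                        ≡⟨ ⁻¹-+ pi pj ⟩
    (pi ℙ.+ pj) ⁻¹                      ∎
    where
    open ≡-Reasoning
    pi = ℕ.parity (toℕ i)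
    pj = ℕ.parity (toℕ j)
    i+1≢n : toℕ i ℕ.+ 1 ≢ n
    i+1≢n i+1≡n = subst T isLast (ℕP.≡⇒≡ᵇ _ _ i+1≡n)
  ... | true = begin
    ℕ.parity (toℕ (rotate 1 i)) ℙ.+ ℕ.parity (toℕ (rotate r j))  ≡⟨ cong₂ ℙ._+_ (cong ℕ.parity (toℕ-rotate-last i i+1≡n)) (parity-rotate 2∣m r j) ⟩
    pj ℙ.+ ℕ.parity r                                            ≡⟨ cong (pj ℙ.+_) (parity-sum-even r n (subst (2 ∣_) (ℕP.+-comm n r) 2∣n+r)) ⟩
    pj ℙ.+ ℕ.parity n                                            ≡⟨ cong (λ k → pj ℙ.+ ℕ.parity k) (trans (sym i+1≡n) (ℕP.+-comm (toℕ i) 1)) ⟩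
    pj ℙ.+ ℕ.parity (suc (toℕ i))                                ≡⟨ cong (pj ℙ.+_) (parity-suc (toℕ i)) ⟩
    pj ℙ.+ pi ⁻¹                                                 ≡⟨ +-⁻¹ pj pi ⟩
    (pj ℙ.+ pi) ⁻¹                                               ≡⟨ cong _⁻¹ (ℙP.+-comm pj pi) ⟩
    (pi ℙ.+ pj) ⁻¹                                               ∎
    where
    open ≡-Reasoning
    pi = ℕ.parity (toℕ i)
    pj = ℕ.parity (toℕ j)
    i+1≡n : toℕ i ℕ.+ 1 ≡ n
    i+1≡n = ℕP.≡ᵇ⇒≡ _ _ (subst T (sym isLast) tt)

  -- The eight oriented boundary edges of a face f, seen with f as its top-left corner.
  pattern top→    p = inj₁ p
  pattern top←    p = inj₂ (inj₁ p)
  pattern east↓   p = inj₂ (inj₂ (inj₁ p))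
  pattern east↑   p = inj₂ (inj₂ (inj₂ (inj₁ p)))
  pattern bottom← p = inj₂ (inj₂ (inj₂ (inj₂ (inj₁ p))))
  pattern bottom→ p = inj₂ (inj₂ (inj₂ (inj₂ (inj₂ (inj₁ p)))))
  pattern west↑   p = inj₂ (inj₂ (inj₂ (inj₂ (inj₂ (inj₂ (inj₁ p))))))
  pattern west↓   p = inj₂ (inj₂ (inj₂ (inj₂ (inj₂ (inj₂ (inj₂ p))))))

  InSymDiff-sym : ∀ M N {u w} → InSymDiff M N u w → InSymDiff N M u w
  InSymDiff-sym M N (inj₁ p) = inj₂ p
  InSymDiff-sym M N (inj₂ p) = inj₁ p

  mate-sym : ∀ X {u w} → mate X u ≡ w → mate X w ≡ u
  mate-sym X {u} Xu≡w = trans (cong (mate X) (sym Xu≡w)) (invol X u)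

  InSymDiff-mates : ∀ M N {u w} → InSymDiff M N u w → mate M u ≡ w ⊎ mate N u ≡ w
  InSymDiff-mates M N (inj₁ (Mu≡w , _)) = inj₁ Mu≡w
  InSymDiff-mates M N (inj₂ (Nu≡w , _)) = inj₂ Nu≡w

  InSymDiff-agree : ∀ M N {u w} → mate M u ≡ mate N u → ¬ InSymDiff M N u w
  InSymDiff-agree M N Mu≡Nu (inj₁ (Mu≡w , Nu≢w)) = Nu≢w (trans (sym Mu≡Nu) Mu≡w)
  InSymDiff-agree M N Mu≡Nu (inj₂ (Nu≡w , Mu≢w)) = Mu≢w (trans Mu≡Nu Nu≡w)

  weight : PerfectMatching → Vertex → ℤ
  weight M v = if does (mate M v ≟² right v) then sign (colour v) else + 0

  flux : PerfectMatching → ℤ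
  flux M = sum₂ (weight M)

  weight-right : ∀ M {v} → mate M v ≡ right v → weight M v ≡ sign (colour v)
  weight-right M {v} eq = cong (if_then sign (colour v) else + 0) (dec-true (mate M v ≟² right v) eq)

  weight-¬right : ∀ M {v} → mate M v ≢ right v → weight M v ≡ + 0
  weight-¬right M {v} neq = cong (if_then sign (colour v) else + 0) (dec-false (mate M v ≟² right v) neq)

  step : Parity → Vertex → Vertex
  step 0ℙ = right
  step 1ℙ = left

  module _ (s : Vertex → Parity) (s-right : ∀ v → s (right v) ≡ s v ⁻¹) where

    s-left : ∀ v → s (left v) ≡ s v ⁻¹
    s-left v = sym (ℙP.⁻¹-selfInverse (sym (trans (cong s (sym (right-left v))) (s-right (left v)))))

    step-involutive : ∀ v p → s v ≡ p → step (s (step p v)) (step p v) ≡ v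
    step-involutive v 0ℙ sv≡0ℙ = trans (cong (λ q → step q (right v)) (trans (s-right v) (cong _⁻¹ sv≡0ℙ))) (left-right v)
    step-involutive v 1ℙ sv≡1ℙ = trans (cong (λ q → step q (left v)) (trans (s-left v) (cong _⁻¹ sv≡1ℙ))) (right-left v)

    step-adjacent : ∀ v p → Adj v (step p v)
    step-adjacent v 0ℙ = inj₁ refl
    step-adjacent v 1ℙ = inj₂ (inj₁ (sym (right-left v)))

    horizontalMatching : PerfectMatching
    horizontalMatching = record
      { mate  = λ v → step (s v) v
      ; invol = λ v → step-involutive v (s v) refl
      ; adj   = λ v → step-adjacent v (s v)
      }

  direction : ℕ → Vertex → Parity
  direction t (i , j) = rowPhase t (toℕ i) ℙ.+ colour (i , j)

  direction-right : 2 ∣ m → ∀ t v → direction t (right v) ≡ direction t v ⁻¹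
  direction-right 2∣m t (i , j) =
    trans (cong (rowPhase t (toℕ i) ℙ.+_) (colour-right 2∣m (i , j))) (+-⁻¹ (rowPhase t (toℕ i)) _)

  rowMatching : 2 ∣ m → ℕ → PerfectMatching
  rowMatching 2∣m t = horizontalMatching (direction t) (direction-right 2∣m t)

  module Bipartite (2≤n : 2 ≤ n) (3≤m : 3 ≤ m) (2∣m : 2 ∣ m) (2∣n+r : 2 ∣ n ℕ.+ r) where

    v≢down : ∀ v → v ≢ down v
    v≢down v eq = row-down≢ 2≤n v (cong proj₁ (sym eq))

    right≢down : ∀ v → right v ≢ down v
    right≢down v eq = row-down≢ 2≤n v (trans (cong proj₁ (sym eq)) (row-right v))

    right-down≢ : ∀ v → right (down v) ≢ v
    right-down≢ v eq = row-down≢ 2≤n v (trans (sym (row-right (down v))) (cong proj₁ eq))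

    v≢down-right : ∀ v → v ≢ down (right v)
    v≢down-right v eq = row-down≢ 2≤n (right v) (trans (cong proj₁ (sym eq)) (sym (row-right v)))

    faceEdge-right : ∀ f v → FaceEdge f v (right v) → v ≡ f ⊎ v ≡ down f
    faceEdge-right f v (top→ (v≡f , _))        = inj₁ v≡f
    faceEdge-right f v (top← (refl , rv≡f))    = ⊥-elim (right-right≢ 3≤m f rv≡f)
    faceEdge-right f v (east↓ (refl , rv≡c))   = ⊥-elim (right≢down v rv≡c)
    faceEdge-right f v (east↑ (refl , rv≡b))   = ⊥-elim (right-down≢ (right f) rv≡b)
    faceEdge-right f v (bottom← (refl , rv≡d)) =
      ⊥-elim (right-right≢ 3≤m (down f) (trans (cong right (right-down f)) rv≡d))
    faceEdge-right f v (bottom→ (v≡df , _))    = inj₂ v≡df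
    faceEdge-right f v (west↑ (refl , rv≡a))   = ⊥-elim (right-down≢ f rv≡a)
    faceEdge-right f v (west↓ (refl , rv≡d))   = ⊥-elim (right≢down f rv≡d)

    rightEdge-on-face : ∀ M N → ((f , _) : Flip M N) → ∀ {v} → InSymDiff M N v (right v) → v ≡ f ⊎ v ≡ down f
    rightEdge-on-face M N (f , symDiff≡face) {v} = faceEdge-right f v ∘ proj₁ (symDiff≡face v (right v))

    face⊆symDiff : ∀ M N → ((f , _) : Flip M N) → ∀ u w → FaceEdge f u w → InSymDiff M N u w
    face⊆symDiff M N (f , symDiff≡face) u w = proj₂ (symDiff≡face u w)

    weight-off-face : ∀ M N → ((f , _) : Flip M N) → ∀ v → v ≢ f → v ≢ down f → weight M v ≡ weight N v
    weight-off-face M N flip v v≢f v≢df with mate M v ≟² right v | mate N v ≟² right v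
    ... | yes _       | yes _       = refl
    ... | no  _       | no  _       = refl
    ... | yes Mv≡rv   | no Nv≢rv    = ⊥-elim ([ v≢f , v≢df ]′ (rightEdge-on-face M N flip (inj₁ (Mv≡rv , Nv≢rv))))
    ... | no Mv≢rv    | yes Nv≡rv   = ⊥-elim ([ v≢f , v≢df ]′ (rightEdge-on-face M N flip (inj₂ (Nv≡rv , Mv≢rv))))

    bottom-follows-top : ∀ X Y f → (∀ u w → FaceEdge f u w → InSymDiff X Y u w) → mate X f ≡ right f →
                         mate X (down f) ≡ right (down f) × mate Y (down f) ≢ right (down f)
    bottom-follows-top X Y f boundary⊆symDiff Xf≡b with boundary⊆symDiff (down f) (down (right f)) (bottom→ (refl , refl))
    ... | inj₁ (Xd≡c , Yd≢c) = trans Xd≡c (sym (right-down f)) , λ Yd≡c → Yd≢c (trans Yd≡c (right-down f))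
    ... | inj₂ (Yd≡c , _) with boundary⊆symDiff f (down f) (west↓ (refl , refl))
    ...   | inj₁ (Xf≡d , _) = ⊥-elim (right≢down f (trans (sym Xf≡b) Xf≡d))
    ...   | inj₂ (Yf≡d , _) = ⊥-elim (v≢down-right f (trans (sym (invol Y f)) (trans (cong (mate Y) Yf≡d) Yd≡c)))

    weight-top-bottom : ∀ X f → mate X f ≡ right f → mate X (down f) ≡ right (down f) →
                        weight X f ℤ.+ weight X (down f) ≡ + 0
    weight-top-bottom X f Xf≡b Xd≡c = begin
      weight X f ℤ.+ weight X (down f)             ≡⟨ cong₂ ℤ._+_ (weight-right X Xf≡b) (weight-right X Xd≡c) ⟩
      sign (colour f) ℤ.+ sign (colour (down f))   ≡⟨ cong (λ p → sign (colour f) ℤ.+ sign p) (colour-down 2∣m 2∣n+r f) ⟩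
      sign (colour f) ℤ.+ sign (colour f ⁻¹)       ≡⟨ sign+sign⁻¹≡0 (colour f) ⟩
      + 0                                          ∎
      where open ≡-Reasoning

    weight-¬top-¬bottom : ∀ Y f → mate Y f ≢ right f → mate Y (down f) ≢ right (down f) →
                          weight Y f ℤ.+ weight Y (down f) ≡ + 0
    weight-¬top-¬bottom Y f Yf≢b Yd≢c = cong₂ ℤ._+_ (weight-¬right Y Yf≢b) (weight-¬right Y Yd≢c)

    weight-on-face : ∀ M N → ((f , _) : Flip M N) →
                     weight M f ℤ.+ weight M (down f) ≡ weight N f ℤ.+ weight N (down f)
    weight-on-face M N flip@(f , _) with face⊆symDiff M N flip f (right f) (top→ (refl , refl))
    ... | inj₁ (Mf≡b , Nf≢b) =
      let Md≡c , Nd≢c = bottom-follows-top M N f (face⊆symDiff M N flip) Mf≡b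
      in trans (weight-top-bottom M f Mf≡b Md≡c) (sym (weight-¬top-¬bottom N f Nf≢b Nd≢c))
    ... | inj₂ (Nf≡b , Mf≢b) =
      let Nd≡c , Md≢c = bottom-follows-top N M f (λ u w → InSymDiff-sym M N ∘ face⊆symDiff M N flip u w) Nf≡b
      in trans (weight-¬top-¬bottom M f Mf≢b Md≢c) (sym (weight-top-bottom N f Nf≡b Nd≡c))

    flux-flip : ∀ M N → Flip M N → flux M ≡ flux N
    flux-flip M N flip@(f , _) =
      sum₂-update₂ (weight M) (weight N) (v≢down f) (weight-off-face M N flip) (weight-on-face M N flip)

    flux-connected : ∀ {M N} → Connected M N → flux M ≡ flux N
    flux-connected         ε                      = refl
    flux-connected {M} (_◅_ {j = K} flip K~N) = trans (flux-flip M K flip) (flux-connected K~N)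

    left≢right : ∀ v → left v ≢ right v
    left≢right v eq = right-right≢ 3≤m v (trans (cong right (sym eq)) (right-left v))

    weight-horizontal : ∀ s s-right v → weight (horizontalMatching s s-right) v ≡ keepIf0ℙ (s v) (sign (colour v))
    weight-horizontal s s-right v = by-direction (s v) refl
      where
      H = horizontalMatching s s-right
      by-direction : ∀ p → s v ≡ p → weight H v ≡ keepIf0ℙ p (sign (colour v))
      by-direction 0ℙ sv≡0ℙ = weight-right H (cong (λ p → step p v) sv≡0ℙ)
      by-direction 1ℙ sv≡1ℙ = weight-¬right H (left≢right v ∘ trans (cong (λ p → step p v) (sym sv≡1ℙ)))

    flux-rowMatching : ∀ q → m ≡ q ℕ.* 2 → ∀ t →
                       flux (rowMatching 2∣m t) ≡ + q ℤ.* sum (λ (i : Fin n) → sign (rowPhase t (toℕ i)))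
    flux-rowMatching q m≡q*2 t = begin
      sum (λ (i : Fin n) → sum λ (j : Fin m) → weight (rowMatching 2∣m t) (i , j))
        ≡⟨ sum-cong-≗ {n} (λ i → sum-cong-≗ {m} λ j → weight-horizontal (direction t) (direction-right 2∣m t) (i , j)) ⟩
      sum (λ (i : Fin n) → sum λ (j : Fin m) → G i (ℕ.parity (toℕ i) ℙ.+ ℕ.parity (toℕ j)))
        ≡⟨ sum-cong-≗ {n} (λ i → ∑-alternating q m≡q*2 (G i) (ℕ.parity (toℕ i))) ⟩
      sum (λ (i : Fin n) → + q ℤ.* (G i 0ℙ ℤ.+ G i 1ℙ))
        ≡⟨ sum-cong-≗ {n} (λ i → cong (+ q ℤ.*_) (keepIf0ℙ-sign (rowPhase t (toℕ i)))) ⟩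
      sum (λ (i : Fin n) → + q ℤ.* sign (rowPhase t (toℕ i)))
        ≡⟨ *-distribˡ-sum (+ q) (λ (i : Fin n) → sign (rowPhase t (toℕ i))) ⟨
      + q ℤ.* sum (λ (i : Fin n) → sign (rowPhase t (toℕ i)))
        ∎
      where
      open ≡-Reasoning
      G : Fin n → Parity → ℤ
      G i c = keepIf0ℙ (rowPhase t (toℕ i) ℙ.+ c) (sign c)

    -- Rotating the two horizontal edges of a face into the two vertical ones is
    -- conjugation of the mate function by the transposition of b and d.
    module SquareRotation (M : PerfectMatching) (f : Face)
                          (top : mate M f ≡ right f) (bottom : mate M (down f) ≡ right (down f)) where

      a b c d : Vertex
      a = f
      b = right f
      c = down (right f)
      d = down f

      Ma≡b : mate M a ≡ b
      Ma≡b = top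

      Md≡c : mate M d ≡ c
      Md≡c = trans bottom (right-down f)

      a≢b : a ≢ b
      a≢b = right≢ (ℕP.<⇒≤ 3≤m) f ∘ sym

      a≢c : a ≢ c
      a≢c = v≢down-right f

      a≢d : a ≢ d
      a≢d = v≢down f

      b≢d : b ≢ d
      b≢d = right≢down f

      c≢b : c ≢ b
      c≢b = v≢down (right f) ∘ sym

      c≢d : c ≢ d
      c≢d = right≢ (ℕP.<⇒≤ 3≤m) (down f) ∘ trans (right-down f)

      τ : Vertex → Vertex
      τ = transpose _≟²_ b d

      rotated : Vertex → Vertex
      rotated = τ ∘ mate M ∘ τ

      rotated-a : rotated a ≡ d
      rotated-a = trans (cong (τ ∘ mate M) (transpose-fixes _≟²_ a≢b a≢d))
                        (trans (cong τ Ma≡b) (transpose-left _≟²_ b d))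

      rotated-b : rotated b ≡ c
      rotated-b = trans (cong (τ ∘ mate M) (transpose-left _≟²_ b d))
                        (trans (cong τ Md≡c) (transpose-fixes _≟²_ c≢b c≢d))

      rotated-c : rotated c ≡ b
      rotated-c = trans (cong (τ ∘ mate M) (transpose-fixes _≟²_ c≢b c≢d))
                        (trans (cong τ (mate-sym M Md≡c)) (transpose-right _≟²_ b d))

      rotated-d : rotated d ≡ a
      rotated-d = trans (cong (τ ∘ mate M) (transpose-right _≟²_ b d))
                        (trans (cong τ (mate-sym M Ma≡b)) (transpose-fixes _≟²_ a≢b a≢d))

      rotated-elsewhere : ∀ {v} → v ≢ a → v ≢ b → v ≢ c → v ≢ d → rotated v ≡ mate M v
      rotated-elsewhere v≢a v≢b v≢c v≢d = trans (cong (τ ∘ mate M) (transpose-fixes _≟²_ v≢b v≢d))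
        (transpose-fixes _≟²_ (λ Mv≡b → v≢a (trans (sym (mate-sym M Mv≡b)) (mate-sym M Ma≡b)))
                              (λ Mv≡d → v≢c (trans (sym (mate-sym M Mv≡d)) Md≡c)))

      data Corner : Vertex → Set where
        corner-a : Corner a
        corner-b : Corner b
        corner-c : Corner c
        corner-d : Corner d

      corner? : ∀ v → Corner v ⊎ (v ≢ a × v ≢ b × v ≢ c × v ≢ d)
      corner? v with v ≟² a | v ≟² b | v ≟² c | v ≟² d
      ... | yes refl | _        | _        | _        = inj₁ corner-a
      ... | no _     | yes refl | _        | _        = inj₁ corner-b
      ... | no _     | no _     | yes refl | _        = inj₁ corner-c
      ... | no _     | no _     | no _     | yes refl = inj₁ corner-d
      ... | no v≢a   | no v≢b   | no v≢c   | no v≢d   = inj₂ (v≢a , v≢b , v≢c , v≢d)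

      rotated-adjacent : ∀ v → Adj v (rotated v)
      rotated-adjacent v with corner? v
      ... | inj₁ corner-a = inj₂ (inj₂ (inj₁ rotated-a))
      ... | inj₁ corner-b = inj₂ (inj₂ (inj₁ rotated-b))
      ... | inj₁ corner-c = inj₂ (inj₂ (inj₂ (cong down (sym rotated-c))))
      ... | inj₁ corner-d = inj₂ (inj₂ (inj₂ (cong down (sym rotated-d))))
      ... | inj₂ (v≢a , v≢b , v≢c , v≢d) = subst (Adj v) (sym (rotated-elsewhere v≢a v≢b v≢c v≢d)) (adj M v)

      rotated-involutive : ∀ v → rotated (rotated v) ≡ v
      rotated-involutive v = begin
        τ (mate M (τ (τ (mate M (τ v)))))  ≡⟨ cong (τ ∘ mate M) (transpose-involutive _≟²_ b d (mate M (τ v))) ⟩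
        τ (mate M (mate M (τ v)))          ≡⟨ cong τ (invol M (τ v)) ⟩
        τ (τ v)                            ≡⟨ transpose-involutive _≟²_ b d v ⟩
        v                                  ∎
        where open ≡-Reasoning

      N : PerfectMatching
      N = record { mate = rotated ; invol = rotated-involutive ; adj = rotated-adjacent }

      symDiff⊆boundary : ∀ u w → InSymDiff M N u w → FaceEdge f u w
      symDiff⊆boundary u w symDiff with corner? u
      ... | inj₂ (u≢a , u≢b , u≢c , u≢d) =
        ⊥-elim (InSymDiff-agree M N (sym (rotated-elsewhere u≢a u≢b u≢c u≢d)) symDiff)
      ... | inj₁ corner-a = [ (λ e → top→    (refl , trans (sym e) Ma≡b))
                            , (λ e → west↓   (refl , trans (sym e) rotated-a)) ]′ (InSymDiff-mates M N symDiff)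
      ... | inj₁ corner-b = [ (λ e → top←    (refl , trans (sym e) (mate-sym M Ma≡b)))
                            , (λ e → east↓   (refl , trans (sym e) rotated-b)) ]′ (InSymDiff-mates M N symDiff)
      ... | inj₁ corner-c = [ (λ e → bottom← (refl , trans (sym e) (mate-sym M Md≡c)))
                            , (λ e → east↑   (refl , trans (sym e) rotated-c)) ]′ (InSymDiff-mates M N symDiff)
      ... | inj₁ corner-d = [ (λ e → bottom→ (refl , trans (sym e) Md≡c))
                            , (λ e → west↑   (refl , trans (sym e) rotated-d)) ]′ (InSymDiff-mates M N symDiff)

      boundary⊆symDiff : ∀ u w → FaceEdge f u w → InSymDiff M N u w
      boundary⊆symDiff _ _ (top→ (refl , refl))    = inj₁ (Ma≡b , λ e → b≢d (trans (sym e) rotated-a))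
      boundary⊆symDiff _ _ (top← (refl , refl))    = inj₁ (mate-sym M Ma≡b , λ e → a≢c (trans (sym e) rotated-b))
      boundary⊆symDiff _ _ (east↓ (refl , refl))   = inj₂ (rotated-b , λ e → a≢c (trans (sym (mate-sym M Ma≡b)) e))
      boundary⊆symDiff _ _ (east↑ (refl , refl))   = inj₂ (rotated-c , λ e → b≢d (trans (sym e) (mate-sym M Md≡c)))
      boundary⊆symDiff _ _ (bottom← (refl , refl)) = inj₁ (mate-sym M Md≡c , λ e → b≢d (trans (sym rotated-c) e))
      boundary⊆symDiff _ _ (bottom→ (refl , refl)) = inj₁ (Md≡c , λ e → a≢c (trans (sym rotated-d) e))
      boundary⊆symDiff _ _ (west↑ (refl , refl))   = inj₂ (rotated-d , λ e → a≢c (trans (sym e) Md≡c))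
      boundary⊆symDiff _ _ (west↓ (refl , refl))   = inj₂ (rotated-a , λ e → b≢d (trans (sym Ma≡b) e))

      flip : Flip M N
      flip = f , λ u w → symDiff⊆boundary u w , boundary⊆symDiff u w

      M≠N : ¬ SameMatching M N
      M≠N same = b≢d (trans (sym Ma≡b) (trans (same a) rotated-a))

    horizontalFace⇒nontrivial : ∀ M f → mate M f ≡ right f → mate M (down f) ≡ right (down f) →
                                NontrivialComponent M
    horizontalFace⇒nontrivial M f top bottom = N , flip ◅ ε , M≠N
      where open SquareRotation M f top bottom

module RowMatchings (L k r : ℕ) (3≤1+k : 3 ≤ suc k) (2∣1+k : 2 ∣ suc k) (2∣2+L+r : 2 ∣ 2 ℕ.+ L ℕ.+ r) where

  open Torus (2 ℕ.+ L) (suc k) r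
  open TorusProperties (2 ℕ.+ L) (suc k) r
  open Bipartite (ℕ.s≤s (ℕ.s≤s ℕ.z≤n)) 3≤1+k 2∣1+k 2∣2+L+r

  -- Rows 0 and 1 have opposite phases, so both horizontal edges of the face at (0 , 0) are present.
  rowMatching-nontrivial : ∀ t → NontrivialComponent (rowMatching 2∣1+k t)
  rowMatching-nontrivial t = horizontalFace⇒nontrivial (rowMatching 2∣1+k t) (Fin.zero , Fin.zero) refl refl

  rowMatching-disconnected : ∀ {s t} → s ≤ L → t ≤ L → Connected (rowMatching 2∣1+k s) (rowMatching 2∣1+k t) → s ≡ t
  rowMatching-disconnected {s} {t} s≤L t≤L Ms~Mt = ∑-sign-rowPhase-injective s≤L t≤L
    (ℤP.*-cancelˡ-≡ (+ q) _ _ {{q≢0}} (begin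
      + q ℤ.* sum (λ (i : Fin (2 ℕ.+ L)) → sign (rowPhase s (toℕ i)))  ≡⟨ flux-rowMatching q 1+k≡q*2 s ⟨
      flux (rowMatching 2∣1+k s)                                          ≡⟨ flux-connected Ms~Mt ⟩
      flux (rowMatching 2∣1+k t)                                          ≡⟨ flux-rowMatching q 1+k≡q*2 t ⟩
      + q ℤ.* sum (λ (i : Fin (2 ℕ.+ L)) → sign (rowPhase t (toℕ i)))  ∎))
    where
    open ≡-Reasoning
    q = _∣_.quotient 2∣1+k
    1+k≡q*2 = _∣_.equality 2∣1+k
    q≢0 : ℤ.NonZero (+ q)
    q≢0 = ℕ.≢-nonZero λ q≡0 → ℕP.0≢1+n (sym (trans 1+k≡q*2 (cong (ℕ._* 2) q≡0)))

theorem4p8 : (n m r : ℕ) .{{_ : NonZero n}} .{{_ : NonZero m}} →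
    3 ≤ n → 4 ≤ m → 1 ≤ r → r ≤ m → 2 ∣ m → 2 ∣ (n + r) →
    let open Torus n m r in
    Σ (Fin (2 * (n / 2) ∸ 1) → PerfectMatching) λ M →
      (∀ i → NontrivialComponent (M i)) ×
      (∀ i j → i ≢ j → ¬ Connected (M i) (M j))
theorem4p8 1 _ _ (ℕ.s≤s ()) _ _ _ _ _
theorem4p8 n@(suc (suc L)) m@(suc k) r _ 4≤m _ _ 2∣m 2∣n+r =
  (λ i → rowMatching 2∣m (toℕ i)) ,
  (λ i → rowMatching-nontrivial (toℕ i)) ,
  (λ i j i≢j Mi~Mj → i≢j (FinP.toℕ-injective (rowMatching-disconnected (below i) (below j) Mi~Mj)))
  where
  open TorusProperties n m r using (rowMatching)
  open RowMatchings L k r (ℕP.<⇒≤ 4≤m) 2∣m 2∣n+r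
  below : (i : Fin (2 * (n / 2) ∸ 1)) → toℕ i ≤ L
  below i = ℕP.≤-pred (ℕP.<-≤-trans (FinP.toℕ<n i) (ℕP.∸-monoˡ-≤ 1 (subst (_≤ n) (ℕP.*-comm (n / 2) 2) (m/n*n≤m n 2))))
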